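{- Let $m_1 \geq 2$ and $m_2 \geq 2$ be relatively prime integers. Then there is no proper group identifying code in $G = K_{m_1} \square K_{m_2}$, i.e., no subgroup $H$ of $V(G)$ with $H \neq \{\mathbf{0}\}$ and $H \neq V(G)$ is an identifying code in $G$.
   Context: $G$ is the Hamming graph with vertex set $\mathbb{Z}_{m_1} \times \mathbb{Z}_{m_2}$ (a group under componentwise modular addition), two vertices adjacent iff they differ in exactly one coordinate. For $C \subseteq V(G)$, $J_C(v) = N[v] \cap C$ with $N[v]$ the closed neighborhood. $C$ is an identifying code if the sets $J_C(v)$, $v \in V(G)$, are all nonempty and pairwise distinct; a group identifying code is an identifying code that is a subgroup of $V(G)$. -}

module Defs where

open import Data.Nat using (ℕ; zero; suc; _+_)
open import Data.Nat.DivMod using (_mod_)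
open import Data.Fin using (Fin; toℕ) renaming (zero to fzero)
open import Data.Product using (_×_; _,_; Σ; ∃)
open import Data.Bool using (Bool; true; false; T)
open import Relation.Binary.PropositionalEquality using (_≡_)
open import Relation.Nullary using (¬_)

addMod : ∀ {m} → Fin m → Fin m → Fin m
addMod {suc k} i j = (toℕ i + toℕ j) mod (suc k)

zeroMod : ∀ {m} → Fin m → Fin m
zeroMod {suc k} _ = fzero

negMod : ∀ {m} → Fin m → Fin m
negMod {suc k} i = (suc k Data.Nat.∸ toℕ i) mod (suc k)

-- Vertex set of the Hamming graph K_m1 □ K_m2 : Z_m1 × Z_m2
V : ℕ → ℕ → Set
V m₁ m₂ = Fin m₁ × Fin m₂

_⊕_ : ∀ {m₁ m₂} → V m₁ m₂ → V m₁ m₂ → V m₁ m₂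
(a , b) ⊕ (c , d) = addMod a c , addMod b d

⊖_ : ∀ {m₁ m₂} → V m₁ m₂ → V m₁ m₂
⊖ (a , b) = negMod a , negMod b

-- the identity element 0 (needs m1, m2 ≥ 1; witnessed by any vertex)
𝟎 : ∀ {m₁ m₂} → V m₁ m₂ → V m₁ m₂
𝟎 (a , b) = zeroMod a , zeroMod b

Subset : ℕ → ℕ → Set
Subset m₁ m₂ = V m₁ m₂ → Bool

_∈_ : ∀ {m₁ m₂} → V m₁ m₂ → Subset m₁ m₂ → Set
v ∈ C = T (C v)

InClosedNbhd : ∀ {m₁ m₂} → V m₁ m₂ → V m₁ m₂ → Set
InClosedNbhd (a , b) (c , d) = (a ≡ c) Data.Sum.⊎ (b ≡ d)
  where import Data.Sum

InJ : ∀ {m₁ m₂} → Subset m₁ m₂ → V m₁ m₂ → V m₁ m₂ → Set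
InJ C v w = InClosedNbhd w v × w ∈ C

IsIdentifyingCode : ∀ {m₁ m₂} → Subset m₁ m₂ → Set
IsIdentifyingCode {m₁} {m₂} C =
  (∀ (v : V m₁ m₂) → ∃ λ w → InJ C v w) ×
  (∀ (u v : V m₁ m₂) → ¬ (u ≡ v) →
     ¬ (∀ w → (InJ C u w → InJ C v w) × (InJ C v w → InJ C u w)))

IsSubgroup : ∀ {m₁ m₂} → Subset m₁ m₂ → Set
IsSubgroup {m₁} {m₂} C =
  (∀ (v : V m₁ m₂) → 𝟎 v ∈ C) ×
  (∀ (u v : V m₁ m₂) → u ∈ C → v ∈ C → (u ⊕ v) ∈ C) ×
  (∀ (u : V m₁ m₂) → u ∈ C → (⊖ u) ∈ C)

IsTrivial : ∀ {m₁ m₂} → Subset m₁ m₂ → Set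
IsTrivial {m₁} {m₂} C = ∀ (v : V m₁ m₂) → v ∈ C → v ≡ 𝟎 v

IsWhole : ∀ {m₁ m₂} → Subset m₁ m₂ → Set
IsWhole {m₁} {m₂} C = ∀ (v : V m₁ m₂) → v ∈ C

module Submission where

-- Since m₁ and m₂ are coprime, some n is 1 modulo m₁ and 0 modulo m₂; multiplying by n
-- shows that (x , y) ∈ H forces (x , 0) ∈ H, and symmetrically (0 , y) ∈ H.  Suppose some
-- (a , 0) is not in H.  Any (x , 0) ∉ H has trace H ∩ (Z_m₁ × {0}), since a code word in
-- its column would project onto (x , 0).  If H contains some (c , 0) with c ≠ 0, then
-- (a , 0) and (a + c , 0) are two such points; otherwise H ⊆ {0} × Z_m₂ and (0 , 0),
-- (0 , 1) both have trace H.  So an identifying subgroup contains both axes, hence all of V.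

open import Defs
open import Data.Nat using (ℕ; zero; suc; _+_; _*_; _∸_; _%_; _≤_; s≤s)
open import Data.Nat.Properties
  using (+-comm; +-assoc; +-identityʳ; *-assoc; *-identityˡ; m∸n+n≡m; <⇒≤)
open import Data.Nat.DivMod
  using (_mod_; %-distribˡ-+; %-distribˡ-*; m%n%n≡m%n; [m+n]%n≡m%n; [m+kn]%n≡m%n; m*n%n≡0; m<n⇒m%n≡m)
open import Data.Nat.Coprimality using (Coprime; coprime-Bézout) renaming (sym to coprime-sym)
open import Data.Nat.GCD using (module Bézout)
open import Data.Nat.Solver using (module +-*-Solver)
open import Data.Fin using (Fin; toℕ) renaming (zero to fzero; suc to fsuc)
open import Data.Fin.Properties using (toℕ-injective; toℕ<n; toℕ-fromℕ<; _≟_)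
open import Data.Product using (_×_; _,_; ∃; proj₁; proj₂; swap)
open import Data.Sum using (inj₁; inj₂) renaming (swap to ⊎-swap)
open import Data.Empty using (⊥-elim)
open import Function using (_∘_)
open import Relation.Binary.PropositionalEquality
open import Relation.Nullary using (¬_)
open import Relation.Nullary.Decidable using (T?; decidable-stable)

private
  variable
    k₁ k₂ : ℕ

module _ {k : ℕ} where
  private
    M : ℕ
    M = suc k

  open ≡-Reasoning

  [m+n%d]%d≡[m+n]%d : ∀ m n → (m + n % M) % M ≡ (m + n) % M
  [m+n%d]%d≡[m+n]%d m n = begin
    (m + n % M) % M          ≡⟨ %-distribˡ-+ m (n % M) M ⟩
    (m % M + n % M % M) % M  ≡⟨ cong (λ z → (m % M + z) % M) (m%n%n≡m%n n M) ⟩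
    (m % M + n % M) % M      ≡⟨ %-distribˡ-+ m n M ⟨
    (m + n) % M              ∎

  toℕ%d≡toℕ : (i : Fin M) → toℕ i % M ≡ toℕ i
  toℕ%d≡toℕ i = m<n⇒m%n≡m (toℕ<n i)

  toℕ-addMod : (i j : Fin M) → toℕ (addMod i j) ≡ (toℕ i + toℕ j) % M
  toℕ-addMod i j = toℕ-fromℕ< _

  toℕ-negMod : (i : Fin M) → toℕ (negMod i) ≡ (M ∸ toℕ i) % M
  toℕ-negMod i = toℕ-fromℕ< _

  addMod-comm : (i j : Fin M) → addMod i j ≡ addMod j i
  addMod-comm i j = cong (_mod M) (+-comm (toℕ i) (toℕ j))

  addMod-identityʳ : (i : Fin M) → addMod i fzero ≡ i
  addMod-identityʳ i = toℕ-injective (begin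
    toℕ (addMod i fzero)   ≡⟨ toℕ-addMod i fzero ⟩
    (toℕ i + 0) % M        ≡⟨ cong (_% M) (+-identityʳ (toℕ i)) ⟩
    toℕ i % M              ≡⟨ toℕ%d≡toℕ i ⟩
    toℕ i                  ∎)

  addMod-identityˡ : (i : Fin M) → addMod fzero i ≡ i
  addMod-identityˡ i = trans (addMod-comm fzero i) (addMod-identityʳ i)

  negMod-addMod-cancelˡ : (i j : Fin M) → addMod (negMod i) (addMod i j) ≡ j
  negMod-addMod-cancelˡ i j = toℕ-injective (begin
    toℕ (addMod (negMod i) (addMod i j))                   ≡⟨ toℕ-addMod (negMod i) (addMod i j) ⟩
    (toℕ (negMod i) + toℕ (addMod i j)) % M                ≡⟨ cong₂ (λ u v → (u + v) % M) (toℕ-negMod i) (toℕ-addMod i j) ⟩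
    ((M ∸ toℕ i) % M + (toℕ i + toℕ j) % M) % M            ≡⟨ %-distribˡ-+ (M ∸ toℕ i) (toℕ i + toℕ j) M ⟨
    ((M ∸ toℕ i) + (toℕ i + toℕ j)) % M                    ≡⟨ cong (_% M) (+-assoc (M ∸ toℕ i) (toℕ i) (toℕ j)) ⟨
    ((M ∸ toℕ i + toℕ i) + toℕ j) % M                      ≡⟨ cong (λ z → (z + toℕ j) % M) (m∸n+n≡m (<⇒≤ (toℕ<n i))) ⟩
    (M + toℕ j) % M                                        ≡⟨ cong (_% M) (+-comm M (toℕ j)) ⟩
    (toℕ j + M) % M                                        ≡⟨ [m+n]%n≡m%n (toℕ j) M ⟩
    toℕ j % M                                              ≡⟨ toℕ%d≡toℕ j ⟩
    toℕ j                                                  ∎)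

  addMod-negMod-cancelʳ : (i j : Fin M) → addMod (addMod i j) (negMod j) ≡ i
  addMod-negMod-cancelʳ i j = begin
    addMod (addMod i j) (negMod j)  ≡⟨ addMod-comm (addMod i j) (negMod j) ⟩
    addMod (negMod j) (addMod i j)  ≡⟨ cong (addMod (negMod j)) (addMod-comm i j) ⟩
    addMod (negMod j) (addMod j i)  ≡⟨ negMod-addMod-cancelˡ j i ⟩
    i                               ∎

  addMod-i-j≡i⇒j≡0 : (i j : Fin M) → addMod i j ≡ i → j ≡ fzero
  addMod-i-j≡i⇒j≡0 i j eq = begin
    j                                   ≡⟨ negMod-addMod-cancelˡ i j ⟨
    addMod (negMod i) (addMod i j)      ≡⟨ cong (addMod (negMod i)) (trans eq (sym (addMod-identityʳ i))) ⟩
    addMod (negMod i) (addMod i fzero)  ≡⟨ negMod-addMod-cancelˡ i fzero ⟩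
    fzero                               ∎

  infixr 7 _·_

  _·_ : ℕ → Fin M → Fin M
  zero  · i = fzero
  suc n · i = addMod i (n · i)

  toℕ-· : ∀ n i → toℕ (n · i) ≡ (n * toℕ i) % M
  toℕ-· zero    i = refl
  toℕ-· (suc n) i = begin
    toℕ (addMod i (n · i))          ≡⟨ toℕ-addMod i (n · i) ⟩
    (toℕ i + toℕ (n · i)) % M       ≡⟨ cong (λ z → (toℕ i + z) % M) (toℕ-· n i) ⟩
    (toℕ i + (n * toℕ i) % M) % M   ≡⟨ [m+n%d]%d≡[m+n]%d (toℕ i) (n * toℕ i) ⟩
    (toℕ i + n * toℕ i) % M         ∎

  n%d≡1⇒n·i≡i : ∀ n i → n % M ≡ 1 → n · i ≡ i
  n%d≡1⇒n·i≡i n i n%M≡1 = toℕ-injective (begin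
    toℕ (n · i)                  ≡⟨ toℕ-· n i ⟩
    (n * toℕ i) % M              ≡⟨ %-distribˡ-* n (toℕ i) M ⟩
    (n % M * (toℕ i % M)) % M    ≡⟨ cong (λ z → (z * (toℕ i % M)) % M) n%M≡1 ⟩
    (1 * (toℕ i % M)) % M        ≡⟨ cong (_% M) (*-identityˡ (toℕ i % M)) ⟩
    toℕ i % M % M                ≡⟨ m%n%n≡m%n (toℕ i) M ⟩
    toℕ i % M                    ≡⟨ toℕ%d≡toℕ i ⟩
    toℕ i                        ∎)

  n%d≡0⇒n·i≡0 : ∀ n i → n % M ≡ 0 → n · i ≡ fzero
  n%d≡0⇒n·i≡0 n i n%M≡0 = toℕ-injective (begin
    toℕ (n · i)                  ≡⟨ toℕ-· n i ⟩
    (n * toℕ i) % M              ≡⟨ %-distribˡ-* n (toℕ i) M ⟩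
    (n % M * (toℕ i % M)) % M    ≡⟨ cong (λ z → (z * (toℕ i % M)) % M) n%M≡0 ⟩
    0                            ∎)

coprime⇒∃[n]n%m≡1×n%o≡0 : ∀ k₁ k₂ → Coprime (suc (suc k₁)) (suc k₂) →
  ∃ λ n → n % suc (suc k₁) ≡ 1 × n % suc k₂ ≡ 0
coprime⇒∃[n]n%m≡1×n%o≡0 k₁ k₂ coprime with coprime-Bézout coprime
... | Bézout.-+ x y 1+xm≡yo =
  y * o , trans (cong (_% m) (sym 1+xm≡yo)) ([m+kn]%n≡m%n 1 x m) , m*n%n≡0 y o
  where
  m o : ℕ
  m = suc (suc k₁)
  o = suc k₂
... | Bézout.+- x y 1+yo≡xm = n , n%m≡1 , n%o≡0
  where
  open ≡-Reasoning
  open +-*-Solver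
  m o n : ℕ
  m = suc (suc k₁)
  o = suc k₂
  -- From 1 + y o ≡ x m: n = (m - 1) y o ≡ -(m - 1) ≡ 1 modulo m.
  n = suc k₁ * (y * o)

  n%o≡0 : n % o ≡ 0
  n%o≡0 = trans (cong (_% o) (sym (*-assoc (suc k₁) y o))) (m*n%n≡0 (suc k₁ * y) o)

  n+m≡1+[k₁+1]xm : n + m ≡ 1 + (suc k₁ * x) * m
  n+m≡1+[k₁+1]xm = begin
    n + m                      ≡⟨ solve 3 (λ k y o → (con 1 :+ k) :* (y :* o) :+ (con 2 :+ k)
                                    := con 1 :+ (con 1 :+ k) :* (con 1 :+ y :* o)) refl k₁ y o ⟩
    1 + suc k₁ * (1 + y * o)   ≡⟨ cong (λ z → 1 + suc k₁ * z) 1+yo≡xm ⟩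
    1 + suc k₁ * (x * m)       ≡⟨ cong (1 +_) (*-assoc (suc k₁) x m) ⟨
    1 + (suc k₁ * x) * m       ∎

  n%m≡1 : n % m ≡ 1
  n%m≡1 = begin
    n % m                         ≡⟨ [m+n]%n≡m%n n m ⟨
    (n + m) % m                   ≡⟨ cong (_% m) n+m≡1+[k₁+1]xm ⟩
    (1 + (suc k₁ * x) * m) % m    ≡⟨ [m+kn]%n≡m%n 1 (suc k₁ * x) m ⟩
    1                             ∎

_·ᵥ_ : ℕ → V (suc k₁) (suc k₂) → V (suc k₁) (suc k₂)
n ·ᵥ (x , y) = n · x , n · y

⊕-⊖-cancelʳ : (u v : V (suc k₁) (suc k₂)) → (u ⊕ v) ⊕ (⊖ v) ≡ u
⊕-⊖-cancelʳ (a , b) (c , d) = cong₂ _,_ (addMod-negMod-cancelʳ a c) (addMod-negMod-cancelʳ b d)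

module _ {H : Subset (suc k₁) (suc k₂)} (subgroup : IsSubgroup H) where
  private
    ε∈H : ∀ v → 𝟎 v ∈ H
    ε∈H = proj₁ subgroup
    ⊕-closed : ∀ u v → u ∈ H → v ∈ H → (u ⊕ v) ∈ H
    ⊕-closed = proj₁ (proj₂ subgroup)
    ⊖-closed : ∀ u → u ∈ H → (⊖ u) ∈ H
    ⊖-closed = proj₂ (proj₂ subgroup)

  ·ᵥ-closed : ∀ n u → u ∈ H → (n ·ᵥ u) ∈ H
  ·ᵥ-closed zero    u u∈H = ε∈H u
  ·ᵥ-closed (suc n) u u∈H = ⊕-closed u (n ·ᵥ u) u∈H (·ᵥ-closed n u u∈H)

  ⊕-cancelʳ-∈ : ∀ u v → v ∈ H → (u ⊕ v) ∈ H → u ∈ H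
  ⊕-cancelʳ-∈ u v v∈H u⊕v∈H =
    subst (_∈ H) (⊕-⊖-cancelʳ u v) (⊕-closed (u ⊕ v) (⊖ v) u⊕v∈H (⊖-closed v v∈H))

Proj₁Closed : Subset (suc k₁) (suc k₂) → Set
Proj₁Closed H = ∀ x y → (x , y) ∈ H → (x , fzero) ∈ H

coprime⇒proj₁Closed : Coprime (suc (suc k₁)) (suc k₂) →
  {H : Subset (suc (suc k₁)) (suc k₂)} → IsSubgroup H → Proj₁Closed H
coprime⇒proj₁Closed {k₁} {k₂} coprime {H} subgroup x y xy∈H
  with n , n%m≡1 , n%o≡0 ← coprime⇒∃[n]n%m≡1×n%o≡0 k₁ k₂ coprime =
  subst (_∈ H) (cong₂ _,_ (n%d≡1⇒n·i≡i n x n%m≡1) (n%d≡0⇒n·i≡0 n y n%o≡0))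
    (·ᵥ-closed subgroup n (x , y) xy∈H)

swapᴴ : ∀ {m₁ m₂} → Subset m₁ m₂ → Subset m₂ m₁
swapᴴ H = H ∘ swap

swap-isSubgroup : ∀ {m₁ m₂} {H : Subset m₁ m₂} → IsSubgroup H → IsSubgroup (swapᴴ H)
swap-isSubgroup (ε∈H , ⊕-closed , ⊖-closed) =
  ε∈H ∘ swap , (λ u v → ⊕-closed (swap u) (swap v)) , ⊖-closed ∘ swap

InJ-swap : ∀ {m₁ m₂} (C : Subset m₁ m₂) {v w : V m₁ m₂} →
  InJ C v w → InJ (swapᴴ C) (swap v) (swap w)
InJ-swap C (w∈N[v] , w∈C) = ⊎-swap w∈N[v] , w∈C

SameTrace : ∀ {m₁ m₂} → Subset m₁ m₂ → V m₁ m₂ → V m₁ m₂ → Set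
SameTrace C u v = ∀ w → (InJ C u w → InJ C v w) × (InJ C v w → InJ C u w)

swap-isIdentifyingCode : ∀ {m₁ m₂} {C : Subset m₁ m₂} →
  IsIdentifyingCode C → IsIdentifyingCode (swapᴴ C)
swap-isIdentifyingCode {C = C} (covering , separating) =
  (λ v → let w , w∈J = covering (swap v) in swap w , InJ-swap C w∈J) ,
  λ u v u≢v same → separating (swap u) (swap v) (u≢v ∘ cong swap) (sameTrace-swap same)
  where
  sameTrace-swap : ∀ {u v} → SameTrace (swapᴴ C) u v → SameTrace C (swap u) (swap v)
  sameTrace-swap same w = InJ-swap (swapᴴ C) ∘ proj₁ (same (swap w)) ∘ InJ-swap C
                        , InJ-swap (swapᴴ C) ∘ proj₂ (same (swap w)) ∘ InJ-swap C

module _ {H : Subset (suc k₁) (suc (suc k₂))} (subgroup : IsSubgroup H)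
         (proj₁-closed : Proj₁Closed H) (identifying : IsIdentifyingCode H) where
  private
    separating : ∀ u v → ¬ u ≡ v → ¬ SameTrace H u v
    separating = proj₂ identifying

  off-axis-trace : ∀ {x} y → ¬ (x , fzero) ∈ H → ∀ w → InJ H (x , fzero) w → InJ H (y , fzero) w
  off-axis-trace y x∉H (w₁ , w₂) (inj₁ refl  , w∈H) = ⊥-elim (x∉H (proj₁-closed w₁ w₂ w∈H))
  off-axis-trace y x∉H w         (inj₂ w₂≡0 , w∈H) = inj₂ w₂≡0 , w∈H

  off-axis-sameTrace : ∀ {x y} → ¬ (x , fzero) ∈ H → ¬ (y , fzero) ∈ H →
    SameTrace H (x , fzero) (y , fzero)
  off-axis-sameTrace x∉H y∉H w = off-axis-trace _ x∉H w , off-axis-trace _ y∉H w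

  off-axis⇒trivial-axis : ∀ {a} → ¬ (a , fzero) ∈ H → ∀ c → (c , fzero) ∈ H → c ≡ fzero
  off-axis⇒trivial-axis {a} a∉H c c∈H = decidable-stable (c ≟ fzero) λ c≢0 →
    separating (a , fzero) ((a , fzero) ⊕ (c , fzero))
      (λ eq → c≢0 (addMod-i-j≡i⇒j≡0 a c (sym (cong proj₁ eq))))
      (off-axis-sameTrace a∉H (a∉H ∘ ⊕-cancelʳ-∈ subgroup (a , fzero) (c , fzero) c∈H))

  trivial-axis-trace : (∀ c → (c , fzero) ∈ H → c ≡ fzero) →
    ∀ {y} y′ w → InJ H (fzero , y) w → InJ H (fzero , y′) w
  trivial-axis-trace trivial y′ w         (inj₁ w₁≡0 , w∈H) = inj₁ w₁≡0 , w∈H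
  trivial-axis-trace trivial y′ (w₁ , w₂) (inj₂ refl , w∈H) =
    inj₁ (trivial w₁ (proj₁-closed w₁ w₂ w∈H)) , w∈H

  axis-nontrivial : ¬ (∀ c → (c , fzero) ∈ H → c ≡ fzero)
  axis-nontrivial trivial = separating (fzero , fzero) (fzero , fsuc fzero) (λ ())
    λ w → trivial-axis-trace trivial (fsuc fzero) w , trivial-axis-trace trivial fzero w

  axis⊆H : ∀ a → (a , fzero) ∈ H
  axis⊆H a = decidable-stable (T? (H (a , fzero))) (axis-nontrivial ∘ off-axis⇒trivial-axis)

proposition3p5 : (m₁ m₂ : ℕ) → 2 ≤ m₁ → 2 ≤ m₂ → Coprime m₁ m₂ →
    (H : Subset m₁ m₂) → IsSubgroup H → ¬ IsTrivial H → ¬ IsWhole H →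
    ¬ IsIdentifyingCode H
proposition3p5 _ _ (s≤s (s≤s _)) (s≤s (s≤s _)) coprime H subgroup _ notWhole identifying =
  notWhole λ (a , b) →
    subst (_∈ H) (cong₂ _,_ (addMod-identityʳ a) (addMod-identityˡ b))
      (proj₁ (proj₂ subgroup) (a , fzero) (fzero , b) (first-axis a) (second-axis b))
  where
  first-axis : ∀ a → (a , fzero) ∈ H
  first-axis = axis⊆H subgroup (coprime⇒proj₁Closed coprime subgroup) identifying

  swapped : IsSubgroup (swapᴴ H)
  swapped = swap-isSubgroup subgroup

  second-axis : ∀ b → (fzero , b) ∈ H
  second-axis = axis⊆H swapped (coprime⇒proj₁Closed (coprime-sym coprime) swapped)
                       (swap-isIdentifyingCode identifying)
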